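{- For each positive integer $n$, the binary partitions of $n$ can be arranged in a sequence $\mathcal B(n)$ (each binary partition of $n$ occurring exactly once) such that any two adjacent partitions in the sequence differ by an operation of the form $$\cdots+2^k+2^k+\cdots \;\longleftrightarrow\; \cdots+2^{k+1}+\cdots$$ for some $k\ge 0$, i.e. one is obtained from the other by replacing two parts equal to $2^k$ by a single part $2^{k+1}$. Moreover, the sequence runs first through all binary partitions of $n$ that have at least one part equal to $1$, and then through all binary partitions of $n$ that have no part equal to $1$.
   Context: A binary partition of a positive integer $n$ is a partition of $n$ (an unordered multiset of positive integers summing to $n$) in which every part is a power of two ($1,2,4,8,\dots$). -}

module Defs where

open import Data.Nat using (ℕ; suc; _^_; _≥_)
open import Data.List using (List; []; _∷_)
open import Data.Nat.ListAction using (sum)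
open import Data.List.Relation.Unary.All using (All)
open import Data.List.Relation.Unary.Linked using (Linked)
open import Data.List.Relation.Binary.Permutation.Propositional using (_↭_)
open import Data.Product using (Σ; ∃; _×_)
open import Data.Sum using (_⊎_)
open import Relation.Binary.PropositionalEquality using (_≡_)

IsPow2 : ℕ → Set
IsPow2 m = ∃ λ k → m ≡ 2 ^ k

-- A partition is represented canonically as the list of its parts in
-- non-increasing order (so multisets of parts correspond bijectively to lists).
-- A binary partition of n: all parts powers of two, sorted non-increasingly, sum n.
-- (Parts are automatically positive, being powers of two.)
BinaryPartition : ℕ → List ℕ → Set
BinaryPartition n p = All IsPow2 p × Linked _≥_ p × sum p ≡ n

Merge : List ℕ → List ℕ → Set
Merge p q = Σ ℕ λ k → Σ (List ℕ) λ r →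
  (p ↭ (2 ^ k ∷ 2 ^ k ∷ r)) × (q ↭ (2 ^ suc k ∷ r))

Adjacent : List ℕ → List ℕ → Set
Adjacent p q = Merge p q ⊎ Merge q p

-- Every binary partition of n + 1 either has a part 1, and then removing it gives a binary
-- partition of n, or has none, and then n + 1 = 2 m and halving all parts gives a binary
-- partition of m. So B(n + 1) is B(n) with a part 1 appended, followed, when n + 1 = 2 m, by
-- B(m) with all parts doubled. Inductively B(2 m) runs from 1 + ⋯ + 1 to the partition of 2 m
-- into an odd number of equal parts, and B(2 m + 1) ends there plus a part 1. The junction is
-- then the merge 1 + 1 → 2, provided the doubled copy of B(m) runs forwards when m is even
-- and backwards when m is odd.
module Submission where

open import Defs
open import Data.Nat using (ℕ; zero; suc; _+_; _*_; _^_; _≤_; _<_; _≥_; s≤s; ≢-nonZero⁻¹)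
open import Data.Nat.Properties
open import Data.Nat.Induction using (<-rec)
open import Data.Nat.ListAction using (sum)
open import Data.Nat.ListAction.Properties using (sum-++)
open import Data.List using (List; []; _∷_; _++_; _∷ʳ_; [_]; map; replicate; reverse)
open import Data.List.Properties
  using (map-++; map-replicate; unfold-reverse; ∷ʳ-injectiveˡ; map-injective; ++-identityʳ)
open import Data.List.Relation.Unary.All using (All; []; _∷_)
import Data.List.Relation.Unary.All as All
import Data.List.Relation.Unary.All.Properties as All
open import Data.List.Relation.Unary.Any using (here; there)
import Data.List.Relation.Unary.Any.Properties as Any
open import Data.List.Relation.Unary.Linked using (Linked; []; [-]; _∷_)
import Data.List.Relation.Unary.Linked as Linked
import Data.List.Relation.Unary.Linked.Properties as Linked
open import Data.List.Relation.Unary.AllPairs using ([]; _∷_)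
open import Data.List.Relation.Unary.Unique.Propositional using (Unique)
import Data.List.Relation.Unary.Unique.Propositional.Properties as Unique
import Data.List.Relation.Binary.Permutation.Setoid.Properties as PermutationSetoid
open import Data.List.Membership.Propositional using (_∈_; _∉_)
open import Data.List.Membership.Propositional.Properties using (∈-map⁺; ∈-map⁻; ∈-++⁺ˡ; ∈-++⁺ʳ)
open import Data.List.Membership.DecPropositional _≟_ using (_∈?_)
open import Data.List.Relation.Binary.Permutation.Propositional using (_↭_; ↭-sym; ↭-refl; ↭-trans; ↭⇒↭ₛ)
import Data.List.Relation.Binary.Permutation.Propositional.Properties as Permutation
open import Data.Product using (Σ; ∃; ∃₂; _×_; _,_)
import Data.Sum as Sum
import Data.Product as Product
open import Data.Sum using (inj₁)
open import Data.Empty using (⊥-elim)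
open import Function using (_∘_)
open import Relation.Nullary using (¬_; yes; no)
open import Relation.Binary.Definitions using (Symmetric)
open import Relation.Binary.PropositionalEquality
  using (_≡_; _≢_; refl; sym; trans; cong; subst; setoid; module ≡-Reasoning)

data Walk {A : Set} (R : A → A → Set) : A → A → List A → Set where
  done : ∀ {x} → Walk R x x [ x ]
  step : ∀ {x y z xs} → R x y → Walk R y z xs → Walk R x z (x ∷ xs)

module _ {A : Set} {R : A → A → Set} where

  walk⇒linked : ∀ {x z xs} → Walk R x z xs → Linked R xs
  walk⇒linked done = [-]
  walk⇒linked (step r done) = r ∷ [-]
  walk⇒linked (step r w@(step _ _)) = r ∷ walk⇒linked w

  walk-++ : ∀ {x y u v xs ys} → Walk R x y xs → R y u → Walk R u v ys → Walk R x v (xs ++ ys)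
  walk-++ done r w = step r w
  walk-++ (step r′ w′) r w = step r′ (walk-++ w′ r w)

  walk-reverse : Symmetric R → ∀ {x z xs} → Walk R x z xs → Walk R z x (reverse xs)
  walk-reverse sym-R done = done
  walk-reverse sym-R {x} (step {xs = xs} r w) =
    subst (Walk R _ x) (sym (unfold-reverse x xs)) (walk-++ (walk-reverse sym-R w) (sym-R r) done)

walk-map : ∀ {A B : Set} {R : A → A → Set} {S : B → B → Set} (f : A → B) →
  (∀ {a b} → R a b → S (f a) (f b)) →
  ∀ {x z xs} → Walk R x z xs → Walk S (f x) (f z) (map f xs)
walk-map f f-hom done = done
walk-map f f-hom (step r w) = step (f-hom r) (walk-map f f-hom w)

-- Numbers are doubled as n * 2 rather than 2 * n because suc n * 2 reduces to suc (suc (n * 2)).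
data Parity : ℕ → Set where
  even : ∀ t → Parity (t * 2)
  odd  : ∀ t → Parity (suc (t * 2))

parity : ∀ n → Parity n
parity zero = even zero
parity (suc n) with parity n
... | even t = odd t
... | odd t = even (suc t)

even≢odd′ : ∀ m n → m * 2 ≢ suc (n * 2)
even≢odd′ (suc m) (suc n) eq = even≢odd′ m n (suc-injective (suc-injective eq))

2^suc*≡*2 : ∀ k o → 2 ^ suc k * o ≡ 2 ^ k * o * 2
2^suc*≡*2 k o = trans (*-assoc 2 (2 ^ k) o) (*-comm 2 (2 ^ k * o))

pow2*odd : ∀ n → ∃₂ λ k m → suc n ≡ 2 ^ k * suc (m * 2)
pow2*odd = <-rec _ go
  where
  go : ∀ n → (∀ {n′} → n′ < n → ∃₂ λ k m → suc n′ ≡ 2 ^ k * suc (m * 2)) →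
       ∃₂ λ k m → suc n ≡ 2 ^ k * suc (m * 2)
  go n rec with parity n
  ... | even t = 0 , t , sym (*-identityˡ _)
  ... | odd t with rec (s≤s (m≤m*n t 2))
  ...   | k , m , eq = suc k , m , trans (cong (_* 2) eq) (sym (2^suc*≡*2 k _))

addOne : List ℕ → List ℕ
addOne p = p ∷ʳ 1

doubleParts : List ℕ → List ℕ
doubleParts = map (2 *_)

ones : ℕ → List ℕ
ones zero = []
ones (suc n) = addOne (ones n)

doubleParts-ones : ∀ n → doubleParts (ones n) ≡ replicate n 2
doubleParts-ones zero = refl
doubleParts-ones (suc n) = begin
  doubleParts (ones n ∷ʳ 1)    ≡⟨ map-++ (2 *_) (ones n) [ 1 ] ⟩
  doubleParts (ones n) ∷ʳ 2    ≡⟨ cong (_∷ʳ 2) (doubleParts-ones n) ⟩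
  replicate n 2 ∷ʳ 2           ≡⟨ replicate-∷ʳ n ⟩
  replicate (suc n) 2          ∎
  where
  open ≡-Reasoning
  replicate-∷ʳ : ∀ n → replicate n 2 ∷ʳ 2 ≡ replicate (suc n) 2
  replicate-∷ʳ zero = refl
  replicate-∷ʳ (suc n) = cong (2 ∷_) (replicate-∷ʳ n)

doubleParts-addOne : ∀ p → doubleParts (addOne p) ↭ 2 ∷ doubleParts p
doubleParts-addOne p =
  subst (_↭ 2 ∷ doubleParts p) (sym (map-++ (2 *_) p [ 1 ])) (↭-sym (Permutation.∷↭∷ʳ 2 (doubleParts p)))

1∈addOne : ∀ p → 1 ∈ addOne p
1∈addOne p = ∈-++⁺ʳ p (here refl)

1∉doubleParts : ∀ p → 1 ∉ doubleParts p
1∉doubleParts p 1∈ with ∈-map⁻ (2 *_) 1∈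
... | x , _ , eq = even≢odd x 0 (sym eq)

isPow2⇒1≤ : ∀ {m} → IsPow2 m → 1 ≤ m
isPow2⇒1≤ (k , refl) = m^n>0 2 k

sum-addOne : ∀ p → sum (addOne p) ≡ suc (sum p)
sum-addOne p = trans (sum-++ p [ 1 ]) (+-comm (sum p) 1)

sum-doubleParts : ∀ p → sum (doubleParts p) ≡ sum p * 2
sum-doubleParts [] = refl
sum-doubleParts (x ∷ p) = trans (cong (2 * x +_) (sum-doubleParts p))
  (trans (cong (_+ sum p * 2) (*-comm 2 x)) (sym (*-distribʳ-+ 2 x (sum p))))

binaryPartition-zero : ∀ {p} → BinaryPartition 0 p → p ≡ []
binaryPartition-zero {[]} _ = refl
binaryPartition-zero {x ∷ p} (x-pow2 ∷ _ , _ , sum≡0) =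
  ⊥-elim (<⇒≢ (≤-trans (isPow2⇒1≤ x-pow2) (m≤m+n x (sum p))) (sym sum≡0))

binaryPartition-addOne⁺ : ∀ {n p} → BinaryPartition n p → BinaryPartition (suc n) (addOne p)
binaryPartition-addOne⁺ {p = p} (pow2 , sorted , sum≡n) =
  All.++⁺ pow2 ((0 , refl) ∷ []) , addOne-sorted sorted (All.map isPow2⇒1≤ pow2) ,
  trans (sum-addOne p) (cong suc sum≡n)
  where
  addOne-sorted : ∀ {p} → Linked _≥_ p → All (1 ≤_) p → Linked _≥_ (addOne p)
  addOne-sorted [] _ = [-]
  addOne-sorted [-] (1≤x ∷ []) = 1≤x ∷ [-]
  addOne-sorted (x≥y ∷ sorted) (_ ∷ 1≤) = x≥y ∷ addOne-sorted sorted 1≤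

1∈⇒≡addOne : ∀ {p} → All (1 ≤_) p → Linked _≥_ p → 1 ∈ p → ∃ λ q → p ≡ addOne q
1∈⇒≡addOne {x ∷ []} _ _ (here refl) = [] , refl
1∈⇒≡addOne {x ∷ y ∷ p} (_ ∷ 1≤y∷p) (x≥y ∷ sorted) 1∈x∷y∷p =
  Product.map (x ∷_) (cong (x ∷_)) (1∈⇒≡addOne 1≤y∷p sorted (1∈y∷p 1∈x∷y∷p))
  where
  1∈y∷p : 1 ∈ x ∷ y ∷ p → 1 ∈ y ∷ p
  1∈y∷p (here refl) = here (≤-antisym (All.head 1≤y∷p) x≥y)
  1∈y∷p (there 1∈) = 1∈

linked-++⁻ˡ : ∀ {A : Set} {R : A → A → Set} xs {ys} → Linked R (xs ++ ys) → Linked R xs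
linked-++⁻ˡ [] _ = []
linked-++⁻ˡ (x ∷ []) _ = [-]
linked-++⁻ˡ (x ∷ y ∷ xs) (r ∷ rs) = r ∷ linked-++⁻ˡ (y ∷ xs) rs

binaryPartition-addOne⁻ : ∀ {n p} → BinaryPartition (suc n) p → 1 ∈ p →
  ∃ λ q → p ≡ addOne q × BinaryPartition n q
binaryPartition-addOne⁻ (pow2 , sorted , sum≡) 1∈p
  with q , refl ← 1∈⇒≡addOne (All.map isPow2⇒1≤ pow2) sorted 1∈p =
  q , refl , All.++⁻ˡ q pow2 , linked-++⁻ˡ q sorted , suc-injective (trans (sym (sum-addOne q)) sum≡)

binaryPartition-double⁺ : ∀ {n p} → BinaryPartition n p → BinaryPartition (n * 2) (doubleParts p)
binaryPartition-double⁺ {p = p} (pow2 , sorted , sum≡n) =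
  All.map⁺ (All.map (λ { (k , refl) → suc k , refl }) pow2) ,
  Linked.map⁺ (Linked.map (*-monoʳ-≤ 2) sorted) ,
  trans (sum-doubleParts p) (cong (_* 2) sum≡n)

halve : ∀ {p} → All IsPow2 p → 1 ∉ p → ∃ λ q → p ≡ doubleParts q × All IsPow2 q
halve [] _ = [] , refl , []
halve ((zero , refl) ∷ _) 1∉ = ⊥-elim (1∉ (here refl))
halve ((suc k , refl) ∷ pow2) 1∉ with q , refl , pow2′ ← halve pow2 (1∉ ∘ there) =
  2 ^ k ∷ q , refl , (k , refl) ∷ pow2′

binaryPartition-double⁻ : ∀ {n p} → BinaryPartition n p → 1 ∉ p →
  ∃₂ λ m q → n ≡ m * 2 × p ≡ doubleParts q × BinaryPartition m q
binaryPartition-double⁻ (pow2 , sorted , sum≡n) 1∉p with q , refl , pow2′ ← halve pow2 1∉p =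
  sum q , q , trans (sym sum≡n) (sum-doubleParts q) , refl ,
  pow2′ , Linked.map (*-cancelˡ-≤ 2) (Linked.map⁻ sorted) , refl

merge-++ʳ : ∀ {p q} s → Merge p q → Merge (p ++ s) (q ++ s)
merge-++ʳ s (k , r , p↭ , q↭) = k , r ++ s , Permutation.++⁺ʳ s p↭ , Permutation.++⁺ʳ s q↭

merge-doubleParts : ∀ {p q} → Merge p q → Merge (doubleParts p) (doubleParts q)
merge-doubleParts (k , r , p↭ , q↭) =
  suc k , doubleParts r , Permutation.map⁺ (2 *_) p↭ , Permutation.map⁺ (2 *_) q↭

merge-1+1 : ∀ r {q} → q ↭ 2 ∷ r → Merge (addOne (addOne r)) q
merge-1+1 r q↭ = 0 , r , ↭-trans (Permutation.++-assoc r [ 1 ] [ 1 ]) (Permutation.++-comm r (1 ∷ 1 ∷ [])) , q↭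

adjacent-sym : Symmetric Adjacent
adjacent-sym = Sum.swap

adjacent-addOne : ∀ {p q} → Adjacent p q → Adjacent (addOne p) (addOne q)
adjacent-addOne = Sum.map (merge-++ʳ [ 1 ]) (merge-++ʳ [ 1 ])

adjacent-doubleParts : ∀ {p q} → Adjacent p q → Adjacent (doubleParts p) (doubleParts q)
adjacent-doubleParts = Sum.map merge-doubleParts merge-doubleParts

record GrayCode (n : ℕ) (x y : List ℕ) : Set where
  field
    route    : List (List ℕ)
    walk     : Walk Adjacent x y route
    sound    : All (BinaryPartition n) route
    complete : ∀ p → BinaryPartition n p → p ∈ route
    unique   : Unique route

open GrayCode

OnesFirst : List (List ℕ) → Set
OnesFirst ps = Σ (List (List ℕ)) λ ps₁ → Σ (List (List ℕ)) λ ps₂ →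
  (ps ≡ ps₁ ++ ps₂) × All (λ p → 1 ∈ p) ps₁ × All (λ p → ¬ (1 ∈ p)) ps₂

all-1∈addOne : ∀ ps → All (λ p → 1 ∈ p) (map addOne ps)
all-1∈addOne ps = All.map⁺ (All.tabulate λ {p} _ → 1∈addOne p)

all-1∉doubleParts : ∀ ps → All (λ p → ¬ (1 ∈ p)) (map doubleParts ps)
all-1∉doubleParts ps = All.map⁺ (All.tabulate λ {p} _ → 1∉doubleParts p)

onesFirst-addOne : ∀ ps → OnesFirst (map addOne ps)
onesFirst-addOne ps = map addOne ps , [] , sym (++-identityʳ _) , all-1∈addOne ps , []

onesFirst-join : ∀ ps qs → OnesFirst (map addOne ps ++ map doubleParts qs)
onesFirst-join ps qs = map addOne ps , map doubleParts qs , refl , all-1∈addOne ps , all-1∉doubleParts qs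

grayCode-zero : GrayCode 0 [] []
grayCode-zero = record
  { route = [ [] ] ; walk = done ; sound = ([] , [] , refl) ∷ []
  ; complete = λ p bp → here (binaryPartition-zero bp) ; unique = [] ∷ [] }

grayCode-reverse : ∀ {n x y} → GrayCode n x y → GrayCode n y x
grayCode-reverse G = record
  { route = reverse (route G)
  ; walk = walk-reverse adjacent-sym (walk G)
  ; sound = Permutation.All-resp-↭ (↭-sym (Permutation.↭-reverse (route G))) (sound G)
  ; complete = λ p bp → Any.reverse⁺ (complete G p bp)
  ; unique = PermutationSetoid.Unique-resp-↭ (setoid (List ℕ))
               (↭⇒↭ₛ (↭-sym (Permutation.↭-reverse (route G)))) (unique G) }

addOne-injective : ∀ {p q} → addOne p ≡ addOne q → p ≡ q
addOne-injective {p} {q} = ∷ʳ-injectiveˡ p q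

doubleParts-injective : ∀ {p q} → doubleParts p ≡ doubleParts q → p ≡ q
doubleParts-injective = map-injective (*-cancelˡ-≡ _ _ 2)

grayCode-addOne : ∀ {n x y} → GrayCode (n * 2) x y → GrayCode (suc (n * 2)) (addOne x) (addOne y)
grayCode-addOne {n} G = record
  { route = map addOne (route G)
  ; walk = walk-map addOne adjacent-addOne (walk G)
  ; sound = All.map⁺ (All.map binaryPartition-addOne⁺ (sound G))
  ; complete = complete′
  ; unique = Unique.map⁺ addOne-injective (unique G) }
  where
  complete′ : ∀ p → BinaryPartition (suc (n * 2)) p → p ∈ map addOne (route G)
  complete′ p bp with 1 ∈? p
  ... | yes 1∈p with q , refl , bq ← binaryPartition-addOne⁻ bp 1∈p = ∈-map⁺ addOne (complete G q bq)
  ... | no 1∉p with m , _ , odd≡even , _ ← binaryPartition-double⁻ bp 1∉p = ⊥-elim (even≢odd′ m n (sym odd≡even))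

grayCode-join : ∀ {m x y u v} → GrayCode (suc (m * 2)) x y → GrayCode (suc m) u v →
  Adjacent (addOne y) (doubleParts u) → GrayCode (suc m * 2) (addOne x) (doubleParts v)
grayCode-join {m} G H y~u = record
  { route = map addOne (route G) ++ map doubleParts (route H)
  ; walk = walk-++ (walk-map addOne adjacent-addOne (walk G)) y~u
                   (walk-map doubleParts adjacent-doubleParts (walk H))
  ; sound = All.++⁺ (All.map⁺ (All.map binaryPartition-addOne⁺ (sound G)))
                    (All.map⁺ (All.map binaryPartition-double⁺ (sound H)))
  ; complete = complete′
  ; unique = Unique.++⁺ (Unique.map⁺ addOne-injective (unique G)) (Unique.map⁺ doubleParts-injective (unique H))
      λ (∈G , ∈H) → All.lookup (all-1∉doubleParts (route H)) ∈H (All.lookup (all-1∈addOne (route G)) ∈G) }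
  where
  complete′ : ∀ p → BinaryPartition (suc m * 2) p → p ∈ map addOne (route G) ++ map doubleParts (route H)
  complete′ p bp with 1 ∈? p
  ... | yes 1∈p with q , refl , bq ← binaryPartition-addOne⁻ bp 1∈p =
    ∈-++⁺ˡ (∈-map⁺ addOne (complete G q bq))
  ... | no 1∉p with m′ , q , n≡ , refl , bq ← binaryPartition-double⁻ bp 1∉p
                 rewrite *-cancelʳ-≡ (suc m) m′ 2 n≡ =
    ∈-++⁺ʳ (map addOne (route G)) (∈-map⁺ doubleParts (complete H q bq))

-- y is the partition of j * 2 into an odd number of equal parts. Quantifying over all
-- factorisations j = 2 ^ k (2 m + 1) means only their existence (pow2*odd) is ever needed.
Uniform : ℕ → List ℕ → Set
Uniform j y = (j ≡ 0 → y ≡ []) ×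
  (∀ k m → j ≡ 2 ^ k * suc (m * 2) → y ≡ replicate (suc (m * 2)) (2 ^ suc k))

uniform-odd : ∀ t → Uniform (suc (t * 2)) (doubleParts (ones (suc (t * 2))))
uniform-odd t = (λ ()) , all-twos
  where
  all-twos : ∀ k m → suc (t * 2) ≡ 2 ^ k * suc (m * 2) →
             doubleParts (ones (suc (t * 2))) ≡ replicate (suc (m * 2)) (2 ^ suc k)
  all-twos zero m eq rewrite *-identityˡ (suc (m * 2)) | *-cancelʳ-≡ t m 2 (suc-injective eq) =
    doubleParts-ones (suc (m * 2))
  all-twos (suc k) m eq = ⊥-elim (even≢odd′ (2 ^ k * suc (m * 2)) t (sym (trans eq (2^suc*≡*2 k _))))

uniform-double : ∀ {t y} → Uniform (suc t) y → Uniform (suc t * 2) (doubleParts y)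
uniform-double {t} {y} (_ , u) = (λ ()) , doubled
  where
  doubled : ∀ k m → suc t * 2 ≡ 2 ^ k * suc (m * 2) →
            doubleParts y ≡ replicate (suc (m * 2)) (2 ^ suc k)
  doubled zero m eq = ⊥-elim (even≢odd′ (suc t) m (trans eq (*-identityˡ _)))
  doubled (suc k) m eq =
    trans (cong doubleParts (u k m (*-cancelʳ-≡ (suc t) _ 2 (trans eq (2^suc*≡*2 k _)))))
          (map-replicate (2 *_) (suc (m * 2)) _)

uniform-odd⁻ : ∀ {t y} → Uniform (suc (t * 2)) y → y ≡ replicate (suc (t * 2)) 2
uniform-odd⁻ {t} (_ , u) = u 0 t (sym (*-identityˡ _))

uniform-even⁻ : ∀ {t y y′} → Uniform t y → Uniform (t * 2) y′ → y′ ≡ doubleParts y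
uniform-even⁻ {zero} (u₀ , _) (u′₀ , _) rewrite u₀ refl | u′₀ refl = refl
uniform-even⁻ {suc t} (_ , u) (_ , u′) with k , m , eq ← pow2*odd t =
  trans (u′ (suc k) m (trans (cong (_* 2) eq) (sym (2^suc*≡*2 k _))))
        (sym (trans (cong doubleParts (u k m eq)) (map-replicate (2 *_) (suc (m * 2)) _)))

record Arrangement (j : ℕ) : Set where
  field
    last      : List ℕ
    grayCode  : GrayCode (j * 2) (ones (j * 2)) last
    onesFirst : OnesFirst (route grayCode)
    uniform   : Uniform j last

open Arrangement

arrangement-zero : Arrangement 0
arrangement-zero = record
  { last = [] ; grayCode = grayCode-zero
  ; onesFirst = [] , [ [] ] , refl , [] , (λ ()) ∷ []
  ; uniform = (λ _ → refl) , λ k m eq → ⊥-elim (0≢pow2*odd k m eq) }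
  where
  0≢pow2*odd : ∀ k m → 0 ≢ 2 ^ k * suc (m * 2)
  0≢pow2*odd k m eq = ≢-nonZero⁻¹ _ {{m*n≢0 (2 ^ k) (suc (m * 2)) {{m^n≢0 2 k}}}} (sym eq)

arrangement-odd : ∀ t → Arrangement (t * 2) → Arrangement t → Arrangement (suc (t * 2))
arrangement-odd t A H = record
  { last = doubleParts (ones (suc (t * 2)))
  ; grayCode = grayCode-join G H′ junction
  ; onesFirst = onesFirst-join (route G) (route H′)
  ; uniform = uniform-odd t }
  where
  G : GrayCode (suc (t * 2 * 2)) (addOne (ones (t * 2 * 2))) (addOne (last A))
  G = grayCode-addOne {n = t * 2} (grayCode A)
  H′ : GrayCode (suc (t * 2)) (addOne (last H)) (addOne (ones (t * 2)))
  H′ = grayCode-reverse (grayCode-addOne {n = t} (grayCode H))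
  junction : Adjacent (addOne (addOne (last A))) (doubleParts (addOne (last H)))
  junction rewrite uniform-even⁻ (uniform H) (uniform A) =
    inj₁ (merge-1+1 (doubleParts (last H)) (doubleParts-addOne (last H)))

arrangement-even : ∀ t → Arrangement (suc (t * 2)) → Arrangement (suc t) → Arrangement (suc t * 2)
arrangement-even t A H = record
  { last = doubleParts (last H)
  ; grayCode = grayCode-join G (grayCode H) junction
  ; onesFirst = onesFirst-join (route G) (route (grayCode H))
  ; uniform = uniform-double (uniform H) }
  where
  G : GrayCode (suc (suc (t * 2) * 2)) (addOne (ones (suc (t * 2) * 2))) (addOne (last A))
  G = grayCode-addOne {n = suc (t * 2)} (grayCode A)
  junction : Adjacent (addOne (addOne (last A))) (doubleParts (ones (suc t * 2)))
  junction rewrite uniform-odd⁻ {t = t} (uniform A) | doubleParts-ones (suc t * 2) =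
    inj₁ (merge-1+1 (replicate (suc (t * 2)) 2) ↭-refl)

arrangement : ∀ j → Arrangement j
arrangement = <-rec Arrangement go
  where
  go : ∀ j → (∀ {i} → i < j → Arrangement i) → Arrangement j
  go zero _ = arrangement-zero
  go (suc i) rec with parity i
  ... | even t = arrangement-odd t (rec ≤-refl) (rec (s≤s (m≤m*n t 2)))
  ... | odd t = arrangement-even t (rec ≤-refl) (rec (s≤s (s≤s (m≤m*n t 2))))

grayCode-onesFirst : ∀ n → ∃₂ λ x y → Σ (GrayCode n x y) λ G → OnesFirst (route G)
grayCode-onesFirst n with parity n
... | even t = _ , _ , grayCode (arrangement t) , onesFirst (arrangement t)
... | odd t = _ , _ , grayCode-addOne {n = t} (grayCode (arrangement t)) , onesFirst-addOne _

theorem1 : (n : ℕ) → 1 ≤ n →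
    Σ (List (List ℕ)) λ B →
      All (BinaryPartition n) B
      × ((p : List ℕ) → BinaryPartition n p → p ∈ B)
      × Unique B
      × Linked Adjacent B
      × (Σ (List (List ℕ)) λ B₁ → Σ (List (List ℕ)) λ B₂ →
           (B ≡ B₁ ++ B₂)
           × All (λ p → 1 ∈ p) B₁
           × All (λ p → ¬ (1 ∈ p)) B₂)
theorem1 n _ with _ , _ , G , ordered ← grayCode-onesFirst n =
  route G , sound G , complete G , unique G , walk⇒linked (walk G) , ordered
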